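{- Let $\mathcal{D}$ be a database, $\mathcal{A}=(\Sigma,Q,\Delta,I,F)$ an automaton and $s,t$ vertices of $\mathcal{D}$ such that at least one walk from $s$ to $t$ matches $\mathcal{A}$. Let $w_1$ be a node of the tree $\mathcal{T}$ and $w_2$ a strict descendant of $w_1$ in $\mathcal{T}$ such that $\mathrm{src}(w_1)=\mathrm{src}(w_2)$. Then $S(w_1)\cap S(w_2)=\emptyset$.
   Context: A database is $\mathcal{D}=(\Sigma,V,E,\mathrm{src},\mathrm{tgt},\mathrm{lbl})$ with $\mathrm{lbl}:E\to 2^\Sigma$. For a vertex $u$, $\mathrm{In}(u)$ is a fixed array of edges with target $u$, and $\mathrm{tgtidx}(e)$ is the position of $e$ in $\mathrm{In}(\mathrm{tgt}(e))$. A walk $\langle v_0,e_0,\dots,e_{k-1},v_k\rangle$ has length $k$, source $v_0$, target $v_k$ and label set $\{a_0\cdots a_{k-1}:a_i\in\mathrm{lbl}(e_i)\}$; walks concatenate when the target of the first equals the source of the second; $e\cdot w$ denotes prepending edge $e$ to walk $w$; $\langle t\rangle$ is the walk of length 0 at $t$. $\Delta$ is extended to words; $\Delta(X,U)$ and $\Delta^{ -1}(U,Y)$ denote the sets of states reachable from $X$ by a word of $U$, resp. from which a state of $Y$ is reachable by a word of $U$. A walk matches $\mathcal{A}$ if one of its labels is in $L(\mathcal{A})$; $\lambda$ is the minimal length of a walk from $s$ to $t$ matching $\mathcal{A}$, and $[\![\mathcal{A}]\!](\mathcal{D},s,t)$ is the set of walks from $s$ to $t$ of length $\lambda$ matching $\mathcal{A}$.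 Tree $\mathcal{T}$: its nodes are the walks $w$ such that $w'\cdot w\in[\![\mathcal{A}]\!](\mathcal{D},s,t)$ for some walk $w'$; its root is $\langle t\rangle$; the children of $w$ are the nodes of the form $e\cdot w$ with $e$ an edge, ordered by increasing $\mathrm{tgtidx}(e)$. For a node $w$, $S(w)$ is the set of states $q$ for which there exists a walk $w_q$ with $w_q\cdot w\in[\![\mathcal{A}]\!](\mathcal{D},s,t)$ and $q\in\Delta(I,\mathrm{lbl}(w_q))\cap\Delta^{ -1}(\mathrm{lbl}(w),F)$. -}

module Defs where

open import Data.Nat using (ℕ; zero; suc; _≤_)
open import Data.List using (List; []; _∷_)
open import Data.Product using (Σ-syntax; ∃-syntax; _×_)
open import Relation.Binary.PropositionalEquality using (_≡_)

record Database (Σ : Set) : Set₁ where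
  field
    V   : Set
    E   : Set
    src : E → V
    tgt : E → V
    lbl : E → Σ → Set

record Automaton (Σ : Set) : Set₁ where
  field
    Q : Set
    Δ : Q → Σ → Q → Set
    I : Q → Set
    F : Q → Set

module _ {Σ : Set} (D : Database Σ) where
  open Database D

  data Walk : V → V → Set where
    ⟨_⟩ : (v : V) → Walk v v
    _·_ : ∀ {y} (e : E) → Walk (tgt e) y → Walk (src e) y

  infixr 5 _·_

  len : ∀ {x y} → Walk x y → ℕ
  len ⟨ v ⟩ = 0
  len (e · w) = suc (len w)

  _++ʷ_ : ∀ {x y z} → Walk x y → Walk y z → Walk x z
  ⟨ v ⟩ ++ʷ w' = w'
  (e · w) ++ʷ w' = e · (w ++ʷ w')

  infixr 5 _++ʷ_

  data InLbl : ∀ {x y} → Walk x y → List Σ → Set where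
    nil  : ∀ {v} → InLbl ⟨ v ⟩ []
    cons : ∀ {y} {e : E} {w : Walk (tgt e) y} {a : Σ} {as : List Σ} →
           lbl e a → InLbl w as → InLbl (e · w) (a ∷ as)

module _ {Σ : Set} (A : Automaton Σ) where
  open Automaton A

  data Steps : Q → List Σ → Q → Set where
    done : ∀ {q} → Steps q [] q
    step : ∀ {p r q a as} → Δ p a r → Steps r as q → Steps p (a ∷ as) q

  Accepts : List Σ → Set
  Accepts u = ∃[ i ] ∃[ f ] (I i × F f × Steps i u f)

  InΔI : (List Σ → Set) → Q → Set
  InΔI U q = ∃[ i ] ∃[ u ] (I i × U u × Steps i u q)

  InΔ⁻¹F : (List Σ → Set) → Q → Set
  InΔ⁻¹F U q = ∃[ f ] ∃[ u ] (F f × U u × Steps q u f)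

module _ {Σ : Set} (D : Database Σ) (A : Automaton Σ) where
  open Database D
  open Automaton A

  Matches : ∀ {x y} → Walk D x y → Set
  Matches w = ∃[ u ] (InLbl D w u × Accepts A u)

  Answer : (s t : V) → Walk D s t → Set
  Answer s t w = Matches w × ((w' : Walk D s t) → Matches w' → len D w ≤ len D w')

  Node : (s t : V) → ∀ {x} → Walk D x t → Set
  Node s t {x} w = Σ[ w' ∈ Walk D s x ] Answer s t (_++ʷ_ D w' w)

  data StrictDesc (s t : V) : ∀ {x y} → Walk D x t → Walk D y t → Set where
    child : ∀ {e : E} {w : Walk D (tgt e) t} →
            Node s t (e · w) → StrictDesc s t w (e · w)
    there : ∀ {x} {w : Walk D x t} {e : E} {w' : Walk D (tgt e) t} →
            StrictDesc s t w w' → Node s t (e · w') →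
            StrictDesc s t w (e · w')

  InS : (s t : V) → ∀ {x} → Walk D x t → Q → Set
  InS s t {x} w q =
    Σ[ wq ∈ Walk D s x ]
      (Answer s t (_++ʷ_ D wq w) × InΔI A (InLbl D wq) q × InΔ⁻¹F A (InLbl D w) q)

module Submission where

-- If q ∈ S(w₁) ∩ S(w₂), splice the prefix of a minimal answer through w₂ (which reaches q
-- from I) with the suffix w₁ (which leads from q to F). Since src(w₁) = src(w₂) this is a
-- matching walk from s to t, and it is strictly shorter than the answer through w₂ because
-- w₂ strictly extends w₁ — contradicting minimality.

open import Defs
open import Data.Product using (∃-syntax; _×_; _,_)
open import Data.Empty using (⊥)
open import Data.Nat using (suc; _+_; _≤_; _<_)
open import Data.Nat.Properties using (+-monoʳ-<; <⇒≱; m≤n⇒m≤1+n; ≤-refl)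
open import Data.List using (_++_)
open import Relation.Binary.PropositionalEquality using (_≡_; refl; cong; subst₂)

module _ {Σ : Set} (D : Database Σ) where

  len-++ʷ : ∀ {x y z} (a : Walk D x y) (b : Walk D y z) →
            len D (_++ʷ_ D a b) ≡ len D a + len D b
  len-++ʷ ⟨ _ ⟩   b = refl
  len-++ʷ (e · a) b = cong suc (len-++ʷ a b)

  InLbl-++ʷ : ∀ {x y z} {a : Walk D x y} {b : Walk D y z} {u v} →
              InLbl D a u → InLbl D b v → InLbl D (_++ʷ_ D a b) (u ++ v)
  InLbl-++ʷ nil         lb = lb
  InLbl-++ʷ (cons l la) lb = cons l (InLbl-++ʷ la lb)

module _ {Σ : Set} (A : Automaton Σ) where

  Steps-++ : ∀ {p q r u v} → Steps A p u q → Steps A q v r → Steps A p (u ++ v) r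
  Steps-++ done       s′ = s′
  Steps-++ (step d s) s′ = step d (Steps-++ s s′)

module _ {Σ : Set} (D : Database Σ) (A : Automaton Σ) where

  matches-++ʷ : ∀ {x y z} {a : Walk D x y} {b : Walk D y z} {q} →
                InΔI A (InLbl D a) q → InΔ⁻¹F A (InLbl D b) q →
                Matches D A (_++ʷ_ D a b)
  matches-++ʷ (i , u , iI , la , i⇝q) (f , v , fF , lb , q⇝f) =
    u ++ v , InLbl-++ʷ D la lb , i , f , iI , fF , Steps-++ A i⇝q q⇝f

  StrictDesc⇒len< : ∀ {s t x y} {w₁ : Walk D x t} {w₂ : Walk D y t} →
                    StrictDesc D A s t w₁ w₂ → len D w₁ < len D w₂
  StrictDesc⇒len< (child _)   = ≤-refl
  StrictDesc⇒len< (there d _) = m≤n⇒m≤1+n (StrictDesc⇒len< d)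

lemmaB1 : {Σ : Set} (D : Database Σ) (A : Automaton Σ)
          (s t : Database.V D) →
          ∃[ w ] Matches D A {s} {t} w →
          ∀ {x} (w₁ w₂ : Walk D x t) →
          Node D A s t w₁ → StrictDesc D A s t w₁ w₂ →
          ∀ (q : Automaton.Q A) → InS D A s t w₁ q → InS D A s t w₂ q → ⊥
lemmaB1 D A s t _ w₁ w₂ _ w₁≺w₂ q (_ , _ , _ , q⇝F) (wq , (_ , minimal) , I⇝q , _) =
  <⇒≱ shorter longer
  where
    shorter : len D wq + len D w₁ < len D wq + len D w₂
    shorter = +-monoʳ-< (len D wq) (StrictDesc⇒len< D A w₁≺w₂)

    longer : len D wq + len D w₂ ≤ len D wq + len D w₁
    longer = subst₂ _≤_ (len-++ʷ D wq w₂) (len-++ʷ D wq w₁)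
               (minimal (_++ʷ_ D wq w₁) (matches-++ʷ D A I⇝q q⇝F))
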